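{- Let $M$ and $N$ be SF-terms. If $M \rightarrow_{\mathrm{SF}}^{\ast} N$, then $[\![M]\!]_{@} \rightarrow_{\mathrm{SF}^{\mathcal{C}}_{@}}^{\ast} [\![N]\!]_{@}$.
   Context: SF-calculus: terms are given by $M, N ::= \mathbf{S} \mid \mathbf{F} \mid M\,N$ (application, left-associative; no variables). Terms of the form $\mathbf{S}$, $\mathbf{F}$, $\mathbf{S}\,M$, $\mathbf{F}\,M$, $\mathbf{S}\,M\,N$, $\mathbf{F}\,M\,N$ are called factorable forms. The one-step reduction $\rightarrow_{\mathrm{SF}}$ is the smallest relation closed under term contexts satisfying: $\mathbf{S}\,M\,N\,X \rightarrow_{\mathrm{SF}} M\,X\,(N\,X)$; $\mathbf{F}\,O\,M\,N \rightarrow_{\mathrm{SF}} M$ if $O$ is $\mathbf{S}$ or $\mathbf{F}$; $\mathbf{F}\,(P\,Q)\,M\,N \rightarrow_{\mathrm{SF}} N\,P\,Q$ if $P\,Q$ is a factorable form. $\rightarrow_{\mathrm{SF}}^{\ast}$ is its reflexive transitive closure. Curryfied applicative SF-calculus $\mathrm{SF}^{\mathcal{C}}_{@}$: the first-order term rewriting system over the signature with constructors $\mathbf{S}_0,\mathbf{F}_0$ (arity 0), $\mathbf{S}_1,\mathbf{F}_1$ (arity 1), $\mathbf{S}_2,\mathbf{F}_2$ (arity 2), and program symbols $\mathsf{app}$ (arity 2) and $\mathsf{fred}$ (arity 3), with rewrite rules $\mathsf{app}(\mathbf{S}_0,x)\to\mathbf{S}_1(x)$; $\mathsf{app}(\mathbf{S}_1(x),y)\to\mathbf{S}_2(x,y)$;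 $\mathsf{app}(\mathbf{S}_2(x,y),z)\to\mathsf{app}(\mathsf{app}(x,z),\mathsf{app}(y,z))$; $\mathsf{app}(\mathbf{F}_0,x)\to\mathbf{F}_1(x)$; $\mathsf{app}(\mathbf{F}_1(x),y)\to\mathbf{F}_2(x,y)$; $\mathsf{app}(\mathbf{F}_2(x,y),z)\to\mathsf{fred}(x,y,z)$; $\mathsf{fred}(\mathbf{S}_0,y,z)\to y$; $\mathsf{fred}(\mathbf{F}_0,y,z)\to y$; $\mathsf{fred}(\mathbf{S}_1(x),y,z)\to\mathsf{app}(\mathsf{app}(z,\mathbf{S}_0),x)$; $\mathsf{fred}(\mathbf{F}_1(x),y,z)\to\mathsf{app}(\mathsf{app}(z,\mathbf{F}_0),x)$; $\mathsf{fred}(\mathbf{S}_2(p,q),y,z)\to\mathsf{app}(\mathsf{app}(z,\mathsf{app}(\mathbf{S}_0,p)),q)$; $\mathsf{fred}(\mathbf{F}_2(p,q),y,z)\to\mathsf{app}(\mathsf{app}(z,\mathsf{app}(\mathbf{F}_0,p)),q)$. Its one-step reduction $\rightarrow_{\mathrm{SF}^{\mathcal{C}}_{@}}$ is the closure of these rules under substitution and contexts, and $\rightarrow_{\mathrm{SF}^{\mathcal{C}}_{@}}^{\ast}$ is its reflexive transitive closure. The translation $[\![\cdot]\!]_{@}$ from SF-terms to $\mathrm{SF}^{\mathcal{C}}_{@}$-terms: $[\![\mathbf{S}]\!]_{@}=\mathbf{S}_0$, $[\![\mathbf{F}]\!]_{@}=\mathbf{F}_0$, $[\![M\,N]\!]_{@}=\mathsf{app}([\![M]\!]_{@},[\![N]\!]_{@})$.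 -}

module Defs where

open import Relation.Binary.Construct.Closure.ReflexiveTransitive using (Star)

infixl 9 _·_

data SF : Set where
  S F : SF
  _·_ : SF → SF → SF

data Factorable : SF → Set where
  fS   : Factorable S
  fF   : Factorable F
  fSM  : ∀ M → Factorable (S · M)
  fFM  : ∀ M → Factorable (F · M)
  fSMN : ∀ M N → Factorable (S · M · N)
  fFMN : ∀ M N → Factorable (F · M · N)

data Atom : SF → Set where
  aS : Atom S
  aF : Atom F

infix 4 _⟶SF_ _⟶SF*_ _↦_ _⟶C_ _⟶C*_

data _⟶SF_ : SF → SF → Set where
  red-S  : ∀ M N X → S · M · N · X ⟶SF M · X · (N · X)
  red-F₁ : ∀ O M N → Atom O → F · O · M · N ⟶SF M
  red-F₂ : ∀ P Q M N → Factorable (P · Q) → F · (P · Q) · M · N ⟶SF N · P · Q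
  appL   : ∀ {M M'} N → M ⟶SF M' → M · N ⟶SF M' · N
  appR   : ∀ M {N N'} → N ⟶SF N' → M · N ⟶SF M · N'

_⟶SF*_ : SF → SF → Set
_⟶SF*_ = Star _⟶SF_

-- Curryfied applicative SF-calculus SF^C_@ (first-order TRS, ground terms)

data T : Set where
  S₀ F₀ : T
  S₁ F₁ : T → T
  S₂ F₂ : T → T → T
  app   : T → T → T
  fred  : T → T → T → T

data _↦_ : T → T → Set where
  r-S₀ : ∀ x → app S₀ x ↦ S₁ x
  r-S₁ : ∀ x y → app (S₁ x) y ↦ S₂ x y
  r-S₂ : ∀ x y z → app (S₂ x y) z ↦ app (app x z) (app y z)
  r-F₀ : ∀ x → app F₀ x ↦ F₁ x
  r-F₁ : ∀ x y → app (F₁ x) y ↦ F₂ x y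
  r-F₂ : ∀ x y z → app (F₂ x y) z ↦ fred x y z
  f-S₀ : ∀ y z → fred S₀ y z ↦ y
  f-F₀ : ∀ y z → fred F₀ y z ↦ y
  f-S₁ : ∀ x y z → fred (S₁ x) y z ↦ app (app z S₀) x
  f-F₁ : ∀ x y z → fred (F₁ x) y z ↦ app (app z F₀) x
  f-S₂ : ∀ p q y z → fred (S₂ p q) y z ↦ app (app z (app S₀ p)) q
  f-F₂ : ∀ p q y z → fred (F₂ p q) y z ↦ app (app z (app F₀ p)) q

data _⟶C_ : T → T → Set where
  root   : ∀ {s t} → s ↦ t → s ⟶C t
  S₁-c   : ∀ {s t} → s ⟶C t → S₁ s ⟶C S₁ t
  F₁-c   : ∀ {s t} → s ⟶C t → F₁ s ⟶C F₁ t
  S₂-c₁  : ∀ {s t} u → s ⟶C t → S₂ s u ⟶C S₂ t u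
  S₂-c₂  : ∀ u {s t} → s ⟶C t → S₂ u s ⟶C S₂ u t
  F₂-c₁  : ∀ {s t} u → s ⟶C t → F₂ s u ⟶C F₂ t u
  F₂-c₂  : ∀ u {s t} → s ⟶C t → F₂ u s ⟶C F₂ u t
  app-c₁ : ∀ {s t} u → s ⟶C t → app s u ⟶C app t u
  app-c₂ : ∀ u {s t} → s ⟶C t → app u s ⟶C app u t
  fred-c₁ : ∀ {s t} u v → s ⟶C t → fred s u v ⟶C fred t u v
  fred-c₂ : ∀ u {s t} v → s ⟶C t → fred u s v ⟶C fred u t v
  fred-c₃ : ∀ u v {s t} → s ⟶C t → fred u v s ⟶C fred u v t

_⟶C*_ : T → T → Set
_⟶C*_ = Star _⟶C_

⟦_⟧ : SF → T
⟦ S ⟧ = S₀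
⟦ F ⟧ = F₀
⟦ M · N ⟧ = app ⟦ M ⟧ ⟦ N ⟧

module Submission where

-- The curryfied system evaluates a partial application of S or F by
-- packing its arguments into the constructors S₁, S₂, F₁, F₂, and fires
-- the actual SF-rule only when the third argument arrives.

open import Defs
open import Relation.Binary.Construct.Closure.ReflexiveTransitive
  using (ε; _◅_; _◅◅_; gmap)

rule : ∀ {s t} → s ↦ t → s ⟶C* t
rule p = root p ◅ ε

app-left* : ∀ {s t} u → s ⟶C* t → app s u ⟶C* app t u
app-left* u = gmap (λ x → app x u) (app-c₁ u)

app-right* : ∀ {s t} u → s ⟶C* t → app u s ⟶C* app u t
app-right* u = gmap (app u) (app-c₂ u)

fred-first* : ∀ {s t} u v → s ⟶C* t → fred s u v ⟶C* fred t u v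
fred-first* u v = gmap (λ x → fred x u v) (fred-c₁ u v)

S-packs : ∀ M N → ⟦ S · M · N ⟧ ⟶C* S₂ ⟦ M ⟧ ⟦ N ⟧
S-packs M N = app-left* ⟦ N ⟧ (rule (r-S₀ ⟦ M ⟧)) ◅◅ rule (r-S₁ ⟦ M ⟧ ⟦ N ⟧)

F-applied : ∀ M N X → ⟦ F · M · N · X ⟧ ⟶C* fred ⟦ M ⟧ ⟦ N ⟧ ⟦ X ⟧
F-applied M N X =
  app-left* ⟦ X ⟧ (app-left* ⟦ N ⟧ (rule (r-F₀ ⟦ M ⟧)) ◅◅ rule (r-F₁ ⟦ M ⟧ ⟦ N ⟧))
  ◅◅ rule (r-F₂ ⟦ M ⟧ ⟦ N ⟧ ⟦ X ⟧)

fred-atom : ∀ {O} → Atom O → ∀ y z → fred ⟦ O ⟧ y z ⟶C* y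
fred-atom aS y z = rule (f-S₀ y z)
fred-atom aF y z = rule (f-F₀ y z)

-- 'fred' on a compound factorable form P Q applies its third argument
-- to the two components P and Q, after packing P Q into a constructor.
fred-factorable : ∀ {P Q} → Factorable (P · Q) → ∀ y z →
                  fred ⟦ P · Q ⟧ y z ⟶C* app (app z ⟦ P ⟧) ⟦ Q ⟧
fred-factorable (fSM X) y z =
  fred-first* y z (rule (r-S₀ ⟦ X ⟧)) ◅◅ rule (f-S₁ ⟦ X ⟧ y z)
fred-factorable (fFM X) y z =
  fred-first* y z (rule (r-F₀ ⟦ X ⟧)) ◅◅ rule (f-F₁ ⟦ X ⟧ y z)
fred-factorable (fSMN X Y) y z =
  fred-first* y z (app-left* ⟦ Y ⟧ (rule (r-S₀ ⟦ X ⟧)) ◅◅ rule (r-S₁ _ ⟦ Y ⟧))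
  ◅◅ rule (f-S₂ _ ⟦ Y ⟧ y z)
fred-factorable (fFMN X Y) y z =
  fred-first* y z (app-left* ⟦ Y ⟧ (rule (r-F₀ ⟦ X ⟧)) ◅◅ rule (r-F₁ _ ⟦ Y ⟧))
  ◅◅ rule (f-F₂ _ ⟦ Y ⟧ y z)

simulate-step : ∀ {M N} → M ⟶SF N → ⟦ M ⟧ ⟶C* ⟦ N ⟧
simulate-step (red-S M N X) =
  app-left* ⟦ X ⟧ (S-packs M N) ◅◅ rule (r-S₂ ⟦ M ⟧ ⟦ N ⟧ ⟦ X ⟧)
simulate-step (red-F₁ O M N atom) =
  F-applied O M N ◅◅ fred-atom atom ⟦ M ⟧ ⟦ N ⟧
simulate-step (red-F₂ P Q M N factorable) =
  F-applied (P · Q) M N ◅◅ fred-factorable factorable ⟦ M ⟧ ⟦ N ⟧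
simulate-step (appL N p) = app-left* ⟦ N ⟧ (simulate-step p)
simulate-step (appR M p) = app-right* ⟦ M ⟧ (simulate-step p)

mainTheorem1 : ∀ (M N : SF) → M ⟶SF* N → ⟦ M ⟧ ⟶C* ⟦ N ⟧
mainTheorem1 M .M ε = ε
mainTheorem1 M N (p ◅ ps) = simulate-step p ◅◅ mainTheorem1 _ N ps
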